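{- Let $\mathfrak{S}$ be a nonempty board with no isolated point. Then $|\mathfrak{S}|\le|\mathscr{D}(\mathfrak{S})|\le 4|\mathfrak{S}|-8$.
   Context: A board $\mathfrak{S}$ is a finite subset of $\mathbb{Z}^2$. $[P]$ is the function on $\mathfrak{S}$ equal to $1$ at $P$ and $0$ elsewhere. The set of moves $\mathscr{D}(\mathfrak{S})$ consists of all functions $[P]+[Q]-[R]$ with $P,Q,R\in\mathfrak{S}$, $Q=P+v$, $R=P+2v$ for some $v\in\{(\pm1,0),(0,\pm1)\}$; $Q$ is the middle point and $P,R$ the extremities. Two points are neighbors if they are the two extremities of some move; $\equiv$ is the reflexive-transitive closure of this relation. The board has no isolated point if every $P\in\mathfrak{S}$ is $\equiv$-equivalent to the middle point of some move. -}

module Defs where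

open import Data.Nat using (ℕ)
open import Data.Integer as ℤ using (ℤ; +_; -[1+_])
import Data.Integer.Properties as ℤP
open import Data.Product using (_×_; _,_; Σ; proj₁; proj₂)
open import Data.Product.Properties using (≡-dec)
open import Data.Sum using (_⊎_)
open import Data.List using (List; []; _∷_; filter; cartesianProduct; length)
open import Data.List.Membership.Propositional using (_∈_)
import Data.List.Membership.DecPropositional as DecMem
open import Relation.Binary.PropositionalEquality using (_≡_)
open import Relation.Binary.Definitions using (DecidableEquality)
open import Relation.Nullary.Decidable using (_×-dec_)
open import Relation.Binary.Construct.Closure.ReflexiveTransitive using (Star)

Point : Set
Point = ℤ × ℤ

_≟ₚ_ : DecidableEquality Point
_≟ₚ_ = ≡-dec ℤP._≟_ ℤP._≟_

open DecMem _≟ₚ_ using (_∈?_)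

_+ₚ_ : Point → Point → Point
(a , b) +ₚ (c , d) = (a ℤ.+ c , b ℤ.+ d)

-- A board: a finite subset of ℤ², represented by a duplicate-free list
-- (duplicate-freeness is imposed as a hypothesis in the statement).
Board : Set
Board = List Point

dirs : List Point
dirs = (+ 1 , + 0) ∷ (-[1+ 0 ] , + 0) ∷ (+ 0 , + 1) ∷ (+ 0 , -[1+ 0 ]) ∷ []

-- A move [P]+[Q]-[R] with Q = P+v, R = P+2v, all in the board.
-- It is determined by the pair (P , v).
record Move (S : Board) : Set where
  field
    P     : Point
    v     : Point
    v∈    : v ∈ dirs
    P∈S   : P ∈ S
    Q∈S   : (P +ₚ v) ∈ S
    R∈S   : ((P +ₚ v) +ₚ v) ∈ S

  Q : Point
  Q = P +ₚ v

  R : Point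
  R = (P +ₚ v) +ₚ v

-- The set 𝒟(S) of moves, as the list of their (P , v) data.  Distinct
-- pairs (P , v) give distinct functions [P]+[Q]-[R], so the length of this
-- list is |𝒟(S)|.
moves : Board → List (Point × Point)
moves S = filter (λ pv → (((proj₁ pv) +ₚ (proj₂ pv)) ∈? S)
                         ×-dec ((((proj₁ pv) +ₚ (proj₂ pv)) +ₚ (proj₂ pv)) ∈? S))
                 (cartesianProduct S dirs)

Neighbor : (S : Board) → Point → Point → Set
Neighbor S A B = Σ (Move S) λ m →
  (A ≡ Move.P m × B ≡ Move.R m) ⊎ (A ≡ Move.R m × B ≡ Move.P m)

_≈⟨_⟩_ : Point → Board → Point → Set
A ≈⟨ S ⟩ B = Star (Neighbor S) A B

NoIsolatedPoint : Board → Set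
NoIsolatedPoint S = ∀ {A} → A ∈ S → Σ (Move S) λ m → A ≈⟨ S ⟩ Move.Q m

module Submission where

-- Regard every move P, Q, R as an edge P ~ R with middle Q,
-- counting a move and its reverse once ("board edges").  An abstract counting
-- lemma for lists of edges says: if every point of a duplicate-free list V is
-- connected by edges to a middle point (or to a point of an extra list B),
-- then |V| ≤ 2·#edges + |B|; it is proved by deleting edges one at a time.
-- No isolated point means exactly that every point of S is so connected, and
-- each board edge accounts for two moves, so |S| ≤ 2·#edges ≤ |𝒟(S)|.
--
-- Upper bound.  𝒟(S) is a subset of S × dirs, which has 4|S| elements.  For
-- each direction v, the highest and second highest points of S in direction v
-- (measured by the scalar product with v) start no move in direction v; these
-- give eight distinct pairs of S × dirs outside 𝒟(S).

open import Defs
open import Data.Integer as ℤ using (ℤ; +_)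
import Data.Integer.Properties as ℤP
open import Data.Integer.Tactic.RingSolver using (solve-∀)
open import Data.Nat using (suc; _≤_; _+_; _*_; _≤?_; z≤n; s≤s)
open import Data.Nat.Properties using (module ≤-Reasoning; ≤-trans; ≤-reflexive; n≤1+n; +-suc; +-monoʳ-≤; +-identityʳ; *-suc)
open import Data.Product using (_×_; _,_; ∃-syntax; proj₁; proj₂)
open import Data.Sum using (_⊎_; inj₁; inj₂)
open import Data.Empty using (⊥-elim)
open import Function using (_∘_)
open import Data.List using (List; []; _∷_; length; map; _++_; filter; cartesianProduct)
open import Data.List.Properties using (length-removeAt′; length-map; length-++)
open import Data.List.Relation.Unary.Any using (here; there; index; _─_)
import Data.List.Relation.Unary.All as All
open import Data.List.Membership.Propositional using (_∈_; _∉_)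
open import Data.List.Extrema ℤP.≤-totalOrder using (argmax; argmax-sel; f[xs]≤f[argmax])
open import Data.List.Membership.Propositional.Properties
  using (∈-filter⁺; ∈-filter⁻; ∈-cartesianProduct⁺; ∈-cartesianProduct⁻; ∈-map⁺; ∈-map⁻; ∈-++⁻)
open import Data.List.Membership.DecPropositional _≟ₚ_ using (_∈?_)
open import Data.List.Relation.Binary.Subset.Propositional using (_⊆_)
open import Data.List.Relation.Unary.Unique.Propositional using (Unique; _∷_)
import Data.List.Relation.Unary.Unique.Propositional.Properties as UP
open import Data.List.Relation.Unary.AllPairs using (allPairs?)
open import Relation.Binary.PropositionalEquality using (_≡_; refl; sym; trans; cong; cong₂; subst; _≢_; module ≡-Reasoning)
open import Relation.Binary.Construct.Closure.ReflexiveTransitive using (Star; ε; _◅_) renaming (map to Star-map)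
open import Relation.Nullary using (¬_; ¬?; Dec; yes; no)
open import Relation.Nullary.Decidable using (decidable-stable; ¬¬-excluded-middle; from-yes; _×-dec_; _⊎-dec_)

module _ {A : Set} where

  ∈-─⁺ : ∀ {x y} {ys : List A} (x∈ : x ∈ ys) → y ∈ ys → y ≢ x → y ∈ (ys ─ x∈)
  ∈-─⁺ (here refl) (here refl) y≢x = ⊥-elim (y≢x refl)
  ∈-─⁺ (here _)    (there y∈)  _   = y∈
  ∈-─⁺ (there _)   (here y≡)   _   = here y≡
  ∈-─⁺ (there x∈)  (there y∈)  y≢x = there (∈-─⁺ x∈ y∈ y≢x)

  Unique-⊆⇒length-≤ : ∀ {xs ys : List A} → Unique xs → xs ⊆ ys → length xs ≤ length ys
  Unique-⊆⇒length-≤ {[]}     _           _     = z≤n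
  Unique-⊆⇒length-≤ {x ∷ xs} {ys} (x∉xs ∷ u) xs⊆ys =
    ≤-trans (s≤s (Unique-⊆⇒length-≤ u rest⊆)) (≤-reflexive (sym (length-removeAt′ ys (index x∈))))
    where
    x∈ : x ∈ ys
    x∈ = xs⊆ys (here refl)
    rest⊆ : xs ⊆ (ys ─ x∈)
    rest⊆ z∈ = ∈-─⁺ x∈ (xs⊆ys (there z∈)) (λ z≡x → All.lookup x∉xs z∈ (sym z≡x))

module Anchoring {X : Set} where

  record Edge : Set where
    constructor edge
    field
      left mid right : X
  open Edge public

  Joins : Edge → X → X → Set
  Joins e x y = (x ≡ left e × y ≡ right e) ⊎ (x ≡ right e × y ≡ left e)

  Adjacent : List Edge → X → X → Set
  Adjacent E x y = ∃[ e ] e ∈ E × Joins e x y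

  Target : List Edge → List X → X → Set
  Target E B t = t ∈ map mid E ⊎ t ∈ B

  Anchored : List Edge → List X → X → Set
  Anchored E B x = ∃[ t ] Star (Adjacent E) x t × Target E B t

  transfer : ∀ {E B E′ B′} →
             (∀ {t} → Target E B t → Anchored E′ B′ t) →
             (∀ {x y} → Adjacent E x y → Anchored E′ B′ y → Anchored E′ B′ x) →
             ∀ {x} → Anchored E B x → Anchored E′ B′ x
  transfer {E} {E′ = E′} {B′ = B′} target step (t , path , t-target) = along path
    where
    along : ∀ {x} → Star (Adjacent E) x t → Anchored E′ B′ x
    along ε          = target t-target
    along (x~y ◅ p) = step x~y (along p)

  weaken : ∀ {E B B′} → B ⊆ B′ → ∀ {x} → Anchored E B x → Anchored E B′ x
  weaken B⊆B′ (t , path , inj₁ t∈mids) = t , path , inj₁ t∈mids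
  weaken B⊆B′ (t , path , inj₂ t∈B)    = t , path , inj₂ (B⊆B′ t∈B)

  delete-edge : ∀ {e E B B′} → mid e ∷ B ⊆ B′ →
                (∀ {x y} → Joins e x y → Anchored E B′ y → Anchored E B′ x) →
                ∀ {x} → Anchored (e ∷ E) B x → Anchored E B′ x
  delete-edge {e} {E} {B} {B′} mid∷B⊆B′ across = transfer target step
    where
    target : ∀ {t} → Target (e ∷ E) B t → Anchored E B′ t
    target (inj₁ (here t≡mid))   = _ , ε , inj₂ (mid∷B⊆B′ (here t≡mid))
    target (inj₁ (there t∈mids)) = _ , ε , inj₁ t∈mids
    target (inj₂ t∈B)            = _ , ε , inj₂ (mid∷B⊆B′ (there t∈B))
    step : ∀ {x y} → Adjacent (e ∷ E) x y → Anchored E B′ y → Anchored E B′ x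
    step (_ , here refl , x~y) y-anchored = across x~y y-anchored
    step (f , there f∈E , x~y) (t , path , t-target) = t , (f , f∈E , x~y) ◅ path , t-target

  joins-unordered : ∀ {e P R x y} → Joins e P R → (x ≡ P × y ≡ R) ⊎ (x ≡ R × y ≡ P) → Joins e x y
  joins-unordered P~R            (inj₁ (refl , refl)) = P~R
  joins-unordered (inj₁ (p , r)) (inj₂ (refl , refl)) = inj₂ (r , p)
  joins-unordered (inj₂ (p , r)) (inj₂ (refl , refl)) = inj₁ (r , p)

  joined-end : ∀ {e A C x y} → Joins e A C → Joins e x y → x ≡ A ⊎ x ≡ C
  joined-end (inj₁ (refl , refl)) (inj₁ (refl , _)) = inj₁ refl
  joined-end (inj₁ (refl , refl)) (inj₂ (refl , _)) = inj₂ refl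
  joined-end (inj₂ (refl , refl)) (inj₁ (refl , _)) = inj₂ refl
  joined-end (inj₂ (refl , refl)) (inj₂ (refl , _)) = inj₁ refl

  delete-anchored-edge : ∀ {e E B A C} → Joins e A C → Anchored E (mid e ∷ B) A →
                         ∀ {x} → Anchored (e ∷ E) B x → Anchored E (mid e ∷ C ∷ B) x
  delete-anchored-edge {e} {E} {B} {A} {C} A~C A-anchored = delete-edge mid∷B⊆ across
    where
    mid∷B⊆ : mid e ∷ B ⊆ mid e ∷ C ∷ B
    mid∷B⊆ (here t≡mid) = here t≡mid
    mid∷B⊆ (there t∈B)  = there (there t∈B)
    across : ∀ {x y} → Joins e x y → Anchored E (mid e ∷ C ∷ B) y → Anchored E (mid e ∷ C ∷ B) x
    across x~y _ with joined-end {e} A~C x~y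
    ... | inj₁ refl = weaken mid∷B⊆ A-anchored
    ... | inj₂ refl = C , ε , inj₂ (there (here refl))

  -- If neither end of e is anchored without e, then e is never crossed.
  delete-unanchored-edge : ∀ {e E B} → ¬ Anchored E (mid e ∷ B) (left e) →
                           ¬ Anchored E (mid e ∷ B) (right e) →
                           ∀ {x} → Anchored (e ∷ E) B x → Anchored E (mid e ∷ B) x
  delete-unanchored-edge {e} {E} {B} ¬left ¬right = delete-edge (λ t∈ → t∈) across
    where
    across : ∀ {x y} → Joins e x y → Anchored E (mid e ∷ B) y → Anchored E (mid e ∷ B) x
    across (inj₁ (_ , refl)) y-anchored = ⊥-elim (¬right y-anchored)
    across (inj₂ (_ , refl)) y-anchored = ⊥-elim (¬left y-anchored)

  anchored-without-edges : ∀ {B x} → Anchored [] B x → x ∈ B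
  anchored-without-edges (_ , ε , inj₂ x∈B) = x∈B
  anchored-without-edges (_ , ε , inj₁ ())
  anchored-without-edges (_ , (_ , () , _) ◅ _ , _)

  -- Counting lemma: every edge accounts for at most two anchored points
  -- (its middle and one end), every point of B for one.  The proof deletes
  -- edges one at a time; whether an end is anchored is not decidable in
  -- general, but the bound is, so excluded middle may be used.
  anchored-count : (E : List Edge) (B V : List X) → Unique V →
                   (∀ {v} → v ∈ V → Anchored E B v) →
                   length V ≤ length E + length E + length B
  anchored-count [] B V V-unique anchored =
    Unique-⊆⇒length-≤ V-unique (λ v∈V → anchored-without-edges (anchored v∈V))
  anchored-count (e ∷ E) B V V-unique anchored =
    decidable-stable (length V ≤? _) λ ¬bound →
      ¬¬-excluded-middle λ left? → ¬¬-excluded-middle λ right? → ¬bound (by-cases left? right?)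
    where
    n = length E
    b = length B
    two-new-targets : n + n + suc (suc b) ≡ suc n + suc n + b
    two-new-targets = trans (+-suc (n + n) (suc b))
                            (cong suc (trans (+-suc (n + n) b) (cong (_+ b) (sym (+-suc n n)))))
    by-cases : Dec (Anchored E (mid e ∷ B) (left e)) → Dec (Anchored E (mid e ∷ B) (right e)) →
               length V ≤ suc n + suc n + b
    by-cases (yes left-anchored) _ =
      ≤-trans (anchored-count E (mid e ∷ right e ∷ B) V V-unique
                 (λ v∈V → delete-anchored-edge (inj₁ (refl , refl)) left-anchored (anchored v∈V)))
              (≤-reflexive two-new-targets)
    by-cases (no _) (yes right-anchored) =
      ≤-trans (anchored-count E (mid e ∷ left e ∷ B) V V-unique
                 (λ v∈V → delete-anchored-edge (inj₂ (refl , refl)) right-anchored (anchored v∈V)))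
              (≤-reflexive two-new-targets)
    by-cases (no ¬left) (no ¬right) =
      ≤-trans (anchored-count E (mid e ∷ B) V V-unique
                 (λ v∈V → delete-unanchored-edge ¬left ¬right (anchored v∈V)))
              (≤-trans (+-monoʳ-≤ (n + n) (n≤1+n (suc b))) (≤-reflexive two-new-targets))

open Anchoring {Point}

Jumps : Board → Point → Point → Set
Jumps S P v = (P +ₚ v) ∈ S × ((P +ₚ v) +ₚ v) ∈ S

jumps? : (S : Board) (pv : Point × Point) → Dec (Jumps S (proj₁ pv) (proj₂ pv))
jumps? S (P , v) = ((P +ₚ v) ∈? S) ×-dec (((P +ₚ v) +ₚ v) ∈? S)

moves⁺ : ∀ {S P v} → P ∈ S → v ∈ dirs → Jumps S P v → (P , v) ∈ moves S
moves⁺ {S} P∈S v∈dirs jumps = ∈-filter⁺ (jumps? S) (∈-cartesianProduct⁺ P∈S v∈dirs) jumps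

moves⁻ : ∀ {S P v} → (P , v) ∈ moves S → P ∈ S × v ∈ dirs × Jumps S P v
moves⁻ {S} pv∈moves =
  let (pv∈S×dirs , jumps) = ∈-filter⁻ (jumps? S) {xs = cartesianProduct S dirs} pv∈moves
      (P∈S , v∈dirs)      = ∈-cartesianProduct⁻ S dirs pv∈S×dirs
  in P∈S , v∈dirs , jumps

dirs-unique : Unique dirs
dirs-unique = from-yes (allPairs? (λ v w → ¬? (v ≟ₚ w)) dirs)

moves-unique : ∀ {S} → Unique S → Unique (moves S)
moves-unique {S} S-unique = UP.filter⁺ (jumps? S) (UP.cartesianProduct⁺ S-unique dirs-unique)

-ₚ_ : Point → Point
-ₚ (a , b) = (ℤ.- a , ℤ.- b)

-ₚ-dirs : ∀ {v} → v ∈ dirs → -ₚ v ∈ dirs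
-ₚ-dirs (here refl)                         = there (here refl)
-ₚ-dirs (there (here refl))                 = here refl
-ₚ-dirs (there (there (here refl)))         = there (there (there (here refl)))
-ₚ-dirs (there (there (there (here refl)))) = there (there (here refl))

step-back : ∀ P v → ((P +ₚ v) +ₚ v) +ₚ (-ₚ v) ≡ P +ₚ v
step-back (a , b) (c , d) = cong₂ _,_ (back a c) (back b d)
  where
  back : ∀ x y → x ℤ.+ y ℤ.+ y ℤ.+ ℤ.- y ≡ x ℤ.+ y
  back = solve-∀

step-back-twice : ∀ P v → (((P +ₚ v) +ₚ v) +ₚ (-ₚ v)) +ₚ (-ₚ v) ≡ P
step-back-twice (a , b) (c , d) = cong₂ _,_ (back a c) (back b d)
  where
  back : ∀ x y → x ℤ.+ y ℤ.+ y ℤ.+ ℤ.- y ℤ.+ ℤ.- y ≡ x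
  back = solve-∀

reverse : Point × Point → Point × Point
reverse (P , v) = ((P +ₚ v) +ₚ v , -ₚ v)

reverse-involutive : ∀ w → reverse (reverse w) ≡ w
reverse-involutive (P , (c , d)) =
  cong₂ _,_ (step-back-twice P (c , d)) (cong₂ _,_ (ℤP.neg-involutive c) (ℤP.neg-involutive d))

reverse-injective : ∀ {w w′} → reverse w ≡ reverse w′ → w ≡ w′
reverse-injective {w} {w′} eq = begin
  w                     ≡⟨ reverse-involutive w ⟨
  reverse (reverse w)   ≡⟨ cong reverse eq ⟩
  reverse (reverse w′)  ≡⟨ reverse-involutive w′ ⟩
  w′                    ∎
  where open ≡-Reasoning

reverse-moves : ∀ {S w} → w ∈ moves S → reverse w ∈ moves S
reverse-moves {S} {P , v} pv∈moves =
  let (P∈S , v∈dirs , Q∈S , R∈S) = moves⁻ {S} pv∈moves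
  in moves⁺ R∈S (-ₚ-dirs v∈dirs) (subst (_∈ S) (sym (step-back P v)) Q∈S
                                 , subst (_∈ S) (sym (step-back-twice P v)) P∈S)

-- Each pair of opposite directions has one forward representative.
Forward : Point → Set
Forward v = v ≡ (+ 1 , + 0) ⊎ v ≡ (+ 0 , + 1)

forward? : (pv : Point × Point) → Dec (Forward (proj₂ pv))
forward? (_ , v) = (v ≟ₚ (+ 1 , + 0)) ⊎-dec (v ≟ₚ (+ 0 , + 1))

forward-or-backward : ∀ {v} → v ∈ dirs → Forward v ⊎ Forward (-ₚ v)
forward-or-backward (here refl)                         = inj₁ (inj₁ refl)
forward-or-backward (there (here refl))                 = inj₂ (inj₁ refl)
forward-or-backward (there (there (here refl)))         = inj₁ (inj₂ refl)
forward-or-backward (there (there (there (here refl)))) = inj₂ (inj₂ refl)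

forward-not-both : ∀ {v} → Forward v → ¬ Forward (-ₚ v)
forward-not-both (inj₁ refl) (inj₁ ())
forward-not-both (inj₁ refl) (inj₂ ())
forward-not-both (inj₂ refl) (inj₁ ())
forward-not-both (inj₂ refl) (inj₂ ())

moveEdge : Point × Point → Edge
moveEdge (P , v) = edge P (P +ₚ v) ((P +ₚ v) +ₚ v)

forwardMoves : Board → List (Point × Point)
forwardMoves S = filter forward? (moves S)

boardEdges : Board → List Edge
boardEdges S = map moveEdge (forwardMoves S)

move∈moves : ∀ {S} (m : Move S) → (Move.P m , Move.v m) ∈ moves S
move∈moves m = moves⁺ P∈S v∈ (Q∈S , R∈S)
  where open Move m

move-edge : ∀ {S} (m : Move S) →
            ∃[ e ] e ∈ boardEdges S × Move.Q m ≡ mid e × Joins e (Move.P m) (Move.R m)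
move-edge {S} m with forward-or-backward (Move.v∈ m)
... | inj₁ forward = moveEdge (P , v)
                   , ∈-map⁺ moveEdge (∈-filter⁺ forward? (move∈moves m) forward)
                   , refl , inj₁ (refl , refl)
  where open Move m
... | inj₂ backward = moveEdge (reverse (P , v))
                    , ∈-map⁺ moveEdge (∈-filter⁺ forward? (reverse-moves {S} (move∈moves m)) backward)
                    , sym (step-back P v) , inj₂ (sym (step-back-twice P v) , refl)
  where open Move m

neighbor-adjacent : ∀ {S x y} → Neighbor S x y → Adjacent (boardEdges S) x y
neighbor-adjacent (m , x-y-ends) =
  let (e , e∈edges , _ , P~R) = move-edge m
  in e , e∈edges , joins-unordered {e} P~R x-y-ends

board-anchored : ∀ {S} → NoIsolatedPoint S → ∀ {A} → A ∈ S → Anchored (boardEdges S) [] A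
board-anchored nip A∈S =
  let (m , path)                = nip A∈S
      (e , e∈edges , Q≡mid , _) = move-edge m
  in Move.Q m , Star-map neighbor-adjacent path
   , inj₁ (subst (_∈ _) (sym Q≡mid) (∈-map⁺ mid e∈edges))

-- Each edge comes from two distinct moves, its forward move and the reverse.
boardEdges-count : ∀ {S} → Unique S →
                   length (boardEdges S) + length (boardEdges S) ≤ length (moves S)
boardEdges-count {S} S-unique = begin
  length (boardEdges S) + length (boardEdges S) ≡⟨ cong₂ _+_ (length-map moveEdge F) same-length ⟩
  length F + length (map reverse F)             ≡⟨ length-++ F ⟨
  length (F ++ map reverse F)                   ≤⟨ Unique-⊆⇒length-≤ both-unique both⊆moves ⟩
  length (moves S)                              ∎
  where
  open ≤-Reasoning
  F = forwardMoves S
  same-length : length (boardEdges S) ≡ length (map reverse F)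
  same-length = trans (length-map moveEdge F) (sym (length-map reverse F))
  forward⁻ : ∀ {w} → w ∈ F → w ∈ moves S × Forward (proj₂ w)
  forward⁻ = ∈-filter⁻ forward? {xs = moves S}
  F-unique : Unique F
  F-unique = UP.filter⁺ forward? (moves-unique S-unique)
  disjoint : ∀ {w} → ¬ (w ∈ F × w ∈ map reverse F)
  disjoint (w∈F , w∈rev) with ∈-map⁻ reverse w∈rev
  ... | (w′ , w′∈F , refl) = forward-not-both (proj₂ (forward⁻ w′∈F)) (proj₂ (forward⁻ w∈F))
  both-unique : Unique (F ++ map reverse F)
  both-unique = UP.++⁺ F-unique (UP.map⁺ reverse-injective F-unique) disjoint
  both⊆moves : F ++ map reverse F ⊆ moves S
  both⊆moves w∈ with ∈-++⁻ F w∈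
  ... | inj₁ w∈F   = proj₁ (forward⁻ w∈F)
  ... | inj₂ w∈rev with ∈-map⁻ reverse w∈rev
  ...   | (w′ , w′∈F , refl) = reverse-moves {S} (proj₁ (forward⁻ w′∈F))

lower-bound : ∀ {S} → Unique S → NoIsolatedPoint S → length S ≤ length (moves S)
lower-bound {S} S-unique nip = begin
  length S
    ≤⟨ anchored-count (boardEdges S) [] S S-unique (board-anchored nip) ⟩
  length (boardEdges S) + length (boardEdges S) + 0
    ≡⟨ +-identityʳ _ ⟩
  length (boardEdges S) + length (boardEdges S)
    ≤⟨ boardEdges-count S-unique ⟩
  length (moves S) ∎
  where open ≤-Reasoning

height : Point → Point → ℤ
height (c , d) (a , b) = a ℤ.* c ℤ.+ b ℤ.* d

height-expand : ∀ a b c d →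
  (a ℤ.+ c) ℤ.* c ℤ.+ (b ℤ.+ d) ℤ.* d ≡ (c ℤ.* c ℤ.+ d ℤ.* d) ℤ.+ (a ℤ.* c ℤ.+ b ℤ.* d)
height-expand = solve-∀

height-step : ∀ {v} P → v ∈ dirs → height v (P +ₚ v) ≡ ℤ.suc (height v P)
height-step (a , b) (here refl)                         = height-expand a b _ _
height-step (a , b) (there (here refl))                 = height-expand a b _ _
height-step (a , b) (there (there (here refl)))         = height-expand a b _ _
height-step (a , b) (there (there (there (here refl)))) = height-expand a b _ _

step-distinct : ∀ {v} P → v ∈ dirs → P ≢ P +ₚ v
step-distinct {v} P v∈dirs P≡P+v = ℤP.i≢suc[i] (trans (cong (height v) P≡P+v) (height-step P v∈dirs))

no-step-above : ∀ {v M} {L : List Point} → v ∈ dirs →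
                (∀ {y} → y ∈ L → height v y ℤ.≤ height v M) → (M +ₚ v) ∉ L
no-step-above {v} {M} v∈dirs M-highest M+v∈L =
  ℤP.<-irrefl refl (ℤP.suc[i]≤j⇒i<j (subst (ℤ._≤ height v M) (height-step M v∈dirs) (M-highest M+v∈L)))

-- A highest point of L in direction v; the point a ∈ L is a default.
highest : Point → Point → List Point → Point
highest v a L = argmax (height v) a L

highest-∈ : ∀ {v a L} → a ∈ L → highest v a L ∈ L
highest-∈ {v} {a} {L} a∈L with argmax-sel (height v) a L
... | inj₁ highest≡a = subst (_∈ L) (sym highest≡a) a∈L
... | inj₂ highest∈L = highest∈L

highest-max : ∀ v a L {y} → y ∈ L → height v y ℤ.≤ height v (highest v a L)
highest-max v a L = All.lookup (f[xs]≤f[argmax] {f = height v} a L)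

record StuckPair (S : Board) (v A B : Point) : Set where
  field
    A∈S     : A ∈ S
    B∈S     : B ∈ S
    A≢B     : A ≢ B
    A-stuck : ¬ Jumps S A v
    B-stuck : ¬ Jumps S B v

module TopTwo {S : Board} {a b : Point} (a∈S : a ∈ S) (b∈S : b ∈ S) (a≢b : a ≢ b) where

  first : Point → Point
  first v = highest v a S

  first-top : ∀ {v} → v ∈ dirs → (first v +ₚ v) ∉ S
  first-top {v} v∈dirs = no-step-above {M = first v} v∈dirs (highest-max v a S)

  others : Point → List Point
  others v = filter (λ y → ¬? (y ≟ₚ first v)) S

  some-other : ∀ v → ∃[ c ] c ∈ others v
  some-other v with a ≟ₚ first v
  ... | yes a≡first = b , ∈-filter⁺ _ b∈S (λ b≡first → a≢b (trans a≡first (sym b≡first)))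
  ... | no a≢first  = a , ∈-filter⁺ _ a∈S a≢first

  second : Point → Point
  second v = highest v (proj₁ (some-other v)) (others v)

  second-other : ∀ v → second v ∈ S × second v ≢ first v
  second-other v = ∈-filter⁻ (λ y → ¬? (y ≟ₚ first v)) {xs = S} (highest-∈ (proj₂ (some-other v)))

  -- One step above the second highest point is at most the highest one, and
  -- one step above that is outside S.
  second-stuck : ∀ {v} → v ∈ dirs → ¬ Jumps S (second v) v
  second-stuck {v} v∈dirs (Q∈S , R∈S) with (second v +ₚ v) ≟ₚ first v
  ... | yes Q≡first = first-top v∈dirs (subst (λ Q → (Q +ₚ v) ∈ S) Q≡first R∈S)
  ... | no  Q≢first =
    no-step-above {M = second v} v∈dirs (highest-max v _ (others v)) (∈-filter⁺ _ Q∈S Q≢first)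

  stuck-pair : ∀ {v} → v ∈ dirs → StuckPair S v (first v) (second v)
  stuck-pair {v} v∈dirs = record
    { A∈S     = highest-∈ a∈S
    ; B∈S     = proj₁ (second-other v)
    ; A≢B     = λ first≡second → proj₂ (second-other v) (sym first≡second)
    ; A-stuck = λ (Q∈S , _) → first-top v∈dirs Q∈S
    ; B-stuck = second-stuck v∈dirs
    }

length-×dirs : ∀ (xs : List Point) → length (cartesianProduct xs dirs) ≡ 4 * length xs
length-×dirs []       = refl
length-×dirs (x ∷ xs) = trans (cong (λ n → 4 + n) (length-×dirs xs)) (sym (*-suc 4 (length xs)))

moves-bound : ∀ {S} → Unique S → (first second : Point → Point) →
              (∀ {v} → v ∈ dirs → StuckPair S v (first v) (second v)) →
              length (moves S) + 8 ≤ 4 * length S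
moves-bound {S} S-unique first second stuck = begin
  length (moves S) + 8              ≡⟨ length-++ (moves S) ⟨
  length (moves S ++ blocked)       ≤⟨ Unique-⊆⇒length-≤ all-unique all⊆S×dirs ⟩
  length (cartesianProduct S dirs)  ≡⟨ length-×dirs S ⟩
  4 * length S                      ∎
  where
  open ≤-Reasoning
  open StuckPair
  tag : (Point → Point) → Point → Point × Point
  tag f v = f v , v
  tagged : (Point → Point) → List (Point × Point)
  tagged f = map (tag f) dirs
  blocked : List (Point × Point)
  blocked = tagged first ++ tagged second

  blocked⁻ : ∀ {w} → w ∈ blocked → proj₁ w ∈ S × proj₂ w ∈ dirs × ¬ Jumps S (proj₁ w) (proj₂ w)
  blocked⁻ w∈ with ∈-++⁻ (tagged first) w∈
  ... | inj₁ w∈first with ∈-map⁻ (tag first) w∈first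
  ...   | (v , v∈dirs , refl) = A∈S (stuck v∈dirs) , v∈dirs , A-stuck (stuck v∈dirs)
  blocked⁻ w∈ | inj₂ w∈second with ∈-map⁻ (tag second) w∈second
  ...   | (v , v∈dirs , refl) = B∈S (stuck v∈dirs) , v∈dirs , B-stuck (stuck v∈dirs)

  tagged-unique : ∀ f → Unique (tagged f)
  tagged-unique f = UP.map⁺ {f = tag f} (cong proj₂) dirs-unique
  first-second-disjoint : ∀ {w} → ¬ (w ∈ tagged first × w ∈ tagged second)
  first-second-disjoint (w∈first , w∈second) with ∈-map⁻ (tag first) w∈first | ∈-map⁻ (tag second) w∈second
  ... | (v , v∈dirs , refl) | (_ , _ , tags≡) =
    A≢B (stuck v∈dirs) (trans (cong proj₁ tags≡) (cong (second ∘ proj₂) (sym tags≡)))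
  moves-blocked-disjoint : ∀ {w} → ¬ (w ∈ moves S × w ∈ blocked)
  moves-blocked-disjoint {P , v} (w∈moves , w∈blocked) =
    proj₂ (proj₂ (blocked⁻ w∈blocked)) (proj₂ (proj₂ (moves⁻ {S} w∈moves)))

  all-unique : Unique (moves S ++ blocked)
  all-unique = UP.++⁺ (moves-unique S-unique)
                      (UP.++⁺ (tagged-unique first) (tagged-unique second) first-second-disjoint)
                      moves-blocked-disjoint
  all⊆S×dirs : moves S ++ blocked ⊆ cartesianProduct S dirs
  all⊆S×dirs w∈ with ∈-++⁻ (moves S) w∈
  ... | inj₁ w∈moves   = proj₁ (∈-filter⁻ (jumps? S) {xs = cartesianProduct S dirs} w∈moves)
  ... | inj₂ w∈blocked = let (P∈S , v∈dirs , _) = blocked⁻ w∈blocked in ∈-cartesianProduct⁺ P∈S v∈dirs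

-- Upper bound |𝒟(S)| ≤ 4|S| - 8, given one move (whose first two points are distinct).
upper-bound : ∀ {S} → Unique S → Move S → length (moves S) + 8 ≤ 4 * length S
upper-bound S-unique m = moves-bound S-unique first second stuck-pair
  where
  open Move m using (P; v∈; P∈S; Q∈S)
  open TopTwo P∈S Q∈S (step-distinct P v∈)

lemma1 : (S : Board) → Unique S → S ≢ [] → NoIsolatedPoint S →
    (length S ≤ length (moves S)) × (length (moves S) + 8 ≤ 4 * length S)
lemma1 []      _        S≢[] _   = ⊥-elim (S≢[] refl)
lemma1 (A ∷ S) S-unique _    nip =
  lower-bound S-unique nip , upper-bound S-unique (proj₁ (nip (here refl)))
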